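{- Let $n>2$ be an integer and let $x_1,\dots,x_n$ be pairwise distinct complex numbers. Let $L(n)$ be the set of all permutations $\tau$ of $\{1,\dots,n\}$ that are $n$-cycles. Then \[ \sum_{\tau\in L(n)}\prod_{j=1}^{n}\frac{1}{x_{\tau(j)}-x_j}=0. \] -}

module Defs where

open import Level using (Level; _⊔_)
open import Data.Nat using (ℕ; zero; suc; _>_)
open import Data.Fin using (Fin; zero; suc)
open import Data.Fin.Permutation using (Permutation′; _⟨$⟩ʳ_)
open import Data.List using (List; []; _∷_)
open import Data.List.Relation.Unary.All using (All)
open import Data.List.Relation.Unary.Any using (Any)
open import Data.List.Relation.Unary.AllPairs using (AllPairs)
open import Data.Product using (∃; _×_)
open import Relation.Binary.PropositionalEquality using (_≡_)
open import Relation.Nullary using (¬_)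
open import Algebra.Bundles using (CommutativeRing)

-- Fields (setoid-based), with a total inverse: x ⁻¹ is only constrained
-- for x ≉ 0 (the value 0 ⁻¹ is irrelevant for the statement, since all
-- denominators occurring there are nonzero).

record Field (c ℓ : Level) : Set (Level.suc (c ⊔ ℓ)) where
  field
    commutativeRing : CommutativeRing c ℓ
  open CommutativeRing commutativeRing public
  field
    _⁻¹      : Carrier → Carrier
    ⁻¹-cong  : ∀ {x y} → x ≈ y → x ⁻¹ ≈ y ⁻¹
    inverse  : ∀ x → ¬ (x ≈ 0#) → x * (x ⁻¹) ≈ 1#
    0≉1      : ¬ (0# ≈ 1#)

module FieldOps {c ℓ} (F : Field c ℓ) where
  open Field F hiding (zero)

  ℕ·1 : ℕ → Carrier
  ℕ·1 zero    = 0#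
  ℕ·1 (suc m) = 1# + ℕ·1 m

  -- value at x of the monic polynomial a₀ + a₁x + … + a_{d-1}x^{d-1} + x^d
  -- where the list is [a₀, …, a_{d-1}]
  evalMonic : List Carrier → Carrier → Carrier
  evalMonic []       x = 1#
  evalMonic (a ∷ as) x = a + x * evalMonic as x

  ∏ : (n : ℕ) → (Fin n → Carrier) → Carrier
  ∏ zero    f = 1#
  ∏ (suc n) f = f zero * ∏ n (λ j → f (suc j))

  Σlist : ∀ {a} {A : Set a} → List A → (A → Carrier) → Carrier
  Σlist []       f = 0#
  Σlist (t ∷ ts) f = f t + Σlist ts f

record IsCharZeroAlgClosed {c ℓ} (F : Field c ℓ) : Set (c ⊔ ℓ) where
  open Field F hiding (zero)
  open FieldOps F
  field
    charZero  : ∀ m → ¬ (ℕ·1 (suc m) ≈ 0#)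
    algClosed : ∀ (a : Carrier) (as : List Carrier) →
                ∃ λ x → evalMonic (a ∷ as) x ≈ 0#

_^[_]_ : ∀ {n} → Permutation′ n → ℕ → Fin n → Fin n
σ ^[ zero ]  i = i
σ ^[ suc k ] i = σ ⟨$⟩ʳ (σ ^[ k ] i)

-- σ is an n-cycle: its cycle decomposition is a single cycle of length n,
-- i.e. ⟨σ⟩ acts transitively on {1,…,n}.
IsNCycle : ∀ {n} → Permutation′ n → Set
IsNCycle σ = ∀ i j → ∃ λ k → σ ^[ k ] i ≡ j

_≋_ : ∀ {n} → Permutation′ n → Permutation′ n → Set
σ ≋ τ = ∀ i → σ ⟨$⟩ʳ i ≡ τ ⟨$⟩ʳ i

EnumeratesNCycles : ∀ {n} → List (Permutation′ n) → Set
EnumeratesNCycles {n} ts =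
  All IsNCycle ts ×
  (∀ (σ : Permutation′ n) → IsNCycle σ → Any (σ ≋_) ts) ×
  AllPairs (λ σ τ → ¬ (σ ≋ τ)) ts

cycleSum : ∀ {c ℓ} (F : Field c ℓ) {n : ℕ} →
           (Fin n → Field.Carrier F) → List (Permutation′ n) → Field.Carrier F
cycleSum F {n} x L = Σlist L (λ τ → ∏ n (λ j → (x (τ ⟨$⟩ʳ j) - x j) ⁻¹))
  where open Field F hiding (zero)
        open FieldOps F

{-# OPTIONS --safe #-}

-- Fix a point o. If τ is an n-cycle in which o sits between a = τ⁻¹ o and b = τ o
-- (n > 2 makes a, o, b distinct), the partial-fraction identity
--   1 / ((x_b − x_o)(x_o − x_a)) = (1 / (x_o − x_a) − 1 / (x_o − x_b)) / (x_b − x_a)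
-- writes the summand of τ as h τ − h τ′. Here τ′ is τ with o moved one step forward
-- along the cycle, and h τ is the summand of the (n−1)-cycle obtained by cutting o out
-- of τ, divided by x_o − x_a; cutting o out of τ′ gives the same (n−1)-cycle, now with
-- x_o − x_b. Since τ ↦ τ′ permutes the n-cycles, the sum telescopes to 0.

module Submission where

open import Defs
open import Level using (0ℓ)
open import Data.Nat using (ℕ; suc; _>_; s≤s)
open import Data.Fin using (Fin; zero; suc)
open import Data.Fin.Properties using (_≟_)
open import Data.Fin.Permutation
  using (Permutation′; _⟨$⟩ʳ_; _⟨$⟩ˡ_; inverseˡ; inverseʳ; _∘ₚ_; flip; transpose)
import Data.Fin.Permutation.Components as PC
open import Data.Vec.Functional using (Vector; updateAt)
open import Data.Vec.Functional.Properties using (updateAt-updates; updateAt-minimal)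
open import Data.List using (List; []; _∷_; map)
open import Data.List.Relation.Unary.All as All using (All; []; _∷_)
open import Data.List.Relation.Unary.All.Properties using (─⁺)
import Data.List.Relation.Unary.All.Properties as All
open import Data.List.Relation.Unary.Any as Any using (Any; here; there; _─_)
open import Data.List.Relation.Unary.Any.Properties using (lookup-result)
import Data.List.Relation.Unary.Any.Properties as Any
open import Data.List.Relation.Unary.AllPairs using (AllPairs; []; _∷_)
import Data.List.Relation.Unary.AllPairs as AllPairs
import Data.List.Relation.Unary.AllPairs.Properties as AllPairs
import Data.List.Membership.Setoid as Membership
import Data.List.Relation.Unary.Unique.Setoid as Unique
open import Data.Product using (∃; _×_; _,_; proj₁)
open import Data.Sum using (_⊎_; inj₁; inj₂)
open import Data.Maybe using (nothing)
open import Function using (_∘_; const)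
open import Relation.Binary.Bundles using (Setoid)
open import Relation.Binary.PropositionalEquality
  using (_≡_; _≢_; refl; sym; trans; cong)
open import Relation.Nullary using (¬_; yes; no; contradiction)
open import Tactic.RingSolver.Core.AlmostCommutativeRing using (fromCommutativeRing)

_[_]≔_ : ∀ {a} {A : Set a} {n} → Vector A n → Fin n → A → Vector A n
g [ i ]≔ v = updateAt g i (const v)

-- Transpositions, conjugation and n-cycles

module _ {n : ℕ} where

  transpose-matchˡ : (i j : Fin n) → PC.transpose i j i ≡ j
  transpose-matchˡ i j with i ≟ i
  ... | yes _  = refl
  ... | no i≢i = contradiction refl i≢i

  transpose-matchʳ : (i j : Fin n) → PC.transpose i j j ≡ i
  transpose-matchʳ i j with j ≟ i
  ... | yes j≡i = j≡i
  ... | no _ with j ≟ j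
  ...   | yes _  = refl
  ...   | no j≢j = contradiction refl j≢j

  transpose-other : ∀ {i j k : Fin n} → k ≢ i → k ≢ j → PC.transpose i j k ≡ k
  transpose-other {i} {j} {k} k≢i k≢j with k ≟ i
  ... | yes k≡i = contradiction k≡i k≢i
  ... | no _ with k ≟ j
  ...   | yes k≡j = contradiction k≡j k≢j
  ...   | no _    = refl

  ⟨$⟩ʳ-injective : ∀ (π : Permutation′ n) {i j} → π ⟨$⟩ʳ i ≡ π ⟨$⟩ʳ j → i ≡ j
  ⟨$⟩ʳ-injective π {i} {j} eq =
    trans (sym (inverseˡ π)) (trans (cong (π ⟨$⟩ˡ_) eq) (inverseˡ π))

  ⟨$⟩ʳ≡⇒≡⟨$⟩ˡ : ∀ (π : Permutation′ n) {i j} → π ⟨$⟩ʳ i ≡ j → i ≡ π ⟨$⟩ˡ j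
  ⟨$⟩ʳ≡⇒≡⟨$⟩ˡ π eq = trans (sym (inverseˡ π)) (cong (π ⟨$⟩ˡ_) eq)

  ≋-setoid : Setoid 0ℓ 0ℓ
  ≋-setoid = record
    { Carrier       = Permutation′ n
    ; _≈_           = _≋_
    ; isEquivalence = record
      { refl  = λ _ → refl
      ; sym   = λ eq i → sym (eq i)
      ; trans = λ eq eq′ i → trans (eq i) (eq′ i)
      }
    }

  ⟨$⟩ˡ-cong : ∀ {σ τ : Permutation′ n} → σ ≋ τ → ∀ i → σ ⟨$⟩ˡ i ≡ τ ⟨$⟩ˡ i
  ⟨$⟩ˡ-cong {σ} {τ} eq i =
    sym (⟨$⟩ʳ≡⇒≡⟨$⟩ˡ σ (trans (eq (τ ⟨$⟩ˡ i)) (inverseʳ τ)))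

  conjugate : Permutation′ n → Permutation′ n → Permutation′ n
  conjugate π τ = π ∘ₚ τ ∘ₚ flip π

  conjugate-^ : ∀ π τ m i → conjugate π τ ^[ m ] i ≡ π ⟨$⟩ˡ (τ ^[ m ] (π ⟨$⟩ʳ i))
  conjugate-^ π τ 0       i = sym (inverseˡ π)
  conjugate-^ π τ (suc m) i = cong (λ j → π ⟨$⟩ˡ (τ ⟨$⟩ʳ j))
    (trans (cong (π ⟨$⟩ʳ_) (conjugate-^ π τ m i)) (inverseʳ π))

  conjugate-isNCycle : ∀ π {τ} → IsNCycle τ → IsNCycle (conjugate π τ)
  conjugate-isNCycle π {τ} cycle i j =
    let m , τᵐπi≡πj = cycle (π ⟨$⟩ʳ i) (π ⟨$⟩ʳ j)
    in m , trans (conjugate-^ π τ m i) (trans (cong (π ⟨$⟩ˡ_) τᵐπi≡πj) (inverseˡ π))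

  conjugate-cong : ∀ π {σ τ} → σ ≋ τ → conjugate π σ ≋ conjugate π τ
  conjugate-cong π eq i = cong (π ⟨$⟩ˡ_) (eq (π ⟨$⟩ʳ i))

  conjugate-inverseˡ : ∀ π τ → conjugate (flip π) (conjugate π τ) ≋ τ
  conjugate-inverseˡ π τ i =
    trans (inverseʳ π) (cong (τ ⟨$⟩ʳ_) (inverseʳ π))

  conjugate-inverseʳ : ∀ π τ → conjugate π (conjugate (flip π) τ) ≋ τ
  conjugate-inverseʳ π τ i =
    trans (inverseˡ π) (cong (τ ⟨$⟩ʳ_) (inverseˡ π))

  module _ {τ : Permutation′ n} {i : Fin n} where

    fixed⇒^-fixed : τ ⟨$⟩ʳ i ≡ i → ∀ m → τ ^[ m ] i ≡ i
    fixed⇒^-fixed τi≡i 0       = refl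
    fixed⇒^-fixed τi≡i (suc m) = trans (cong (τ ⟨$⟩ʳ_) (fixed⇒^-fixed τi≡i m)) τi≡i

    2-periodic⇒^-2-valued : τ ⟨$⟩ʳ (τ ⟨$⟩ʳ i) ≡ i →
                            ∀ m → τ ^[ m ] i ≡ i ⊎ τ ^[ m ] i ≡ τ ⟨$⟩ʳ i
    2-periodic⇒^-2-valued ττi≡i 0 = inj₁ refl
    2-periodic⇒^-2-valued ττi≡i (suc m) with 2-periodic⇒^-2-valued ττi≡i m
    ... | inj₁ τᵐi≡i  = inj₂ (cong (τ ⟨$⟩ʳ_) τᵐi≡i)
    ... | inj₂ τᵐi≡τi = inj₁ (trans (cong (τ ⟨$⟩ʳ_) τᵐi≡τi) ττi≡i)

    IsNCycle⇒¬fixed : IsNCycle τ → ∀ {j} → j ≢ i → τ ⟨$⟩ʳ i ≢ i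
    IsNCycle⇒¬fixed cycle {j} j≢i τi≡i =
      let m , τᵐi≡j = cycle i j
      in j≢i (trans (sym τᵐi≡j) (fixed⇒^-fixed τi≡i m))

    IsNCycle⇒¬2-periodic : IsNCycle τ → ∀ {j} → j ≢ i → j ≢ τ ⟨$⟩ʳ i →
                           τ ⟨$⟩ʳ (τ ⟨$⟩ʳ i) ≢ i
    IsNCycle⇒¬2-periodic cycle {j} j≢i j≢τi ττi≡i
      with cycle i j
    ... | m , τᵐi≡j with 2-periodic⇒^-2-valued ττi≡i m
    ...   | inj₁ τᵐi≡i  = j≢i (trans (sym τᵐi≡j) τᵐi≡i)
    ...   | inj₂ τᵐi≡τi = j≢τi (trans (sym τᵐi≡j) τᵐi≡τi)

-- Moving a point one step forward along its cycle

module Advance {n : ℕ} (o : Fin n) where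

  -- In cycle notation (… a o b c …) becomes (… a b o c …).
  advance : Permutation′ n → Permutation′ n
  advance τ = conjugate (transpose o (τ ⟨$⟩ʳ o)) τ

  retreat : Permutation′ n → Permutation′ n
  retreat σ = conjugate (flip (transpose o (σ ⟨$⟩ˡ o))) σ

  advance-cong : ∀ {σ τ} → σ ≋ τ → advance σ ≋ advance τ
  advance-cong {σ} {τ} eq i =
    trans (cong (λ b → conjugate (transpose o b) σ ⟨$⟩ʳ i) (eq o))
          (conjugate-cong (transpose o (τ ⟨$⟩ʳ o)) {σ} {τ} eq i)

  retreat-cong : ∀ {σ τ} → σ ≋ τ → retreat σ ≋ retreat τ
  retreat-cong {σ} {τ} eq i =
    trans (cong (λ a → conjugate (flip (transpose o a)) σ ⟨$⟩ʳ i) (⟨$⟩ˡ-cong {σ = σ} {τ = τ} eq o))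
          (conjugate-cong (flip (transpose o (τ ⟨$⟩ˡ o))) {σ} {τ} eq i)

  advance-succ : ∀ τ → advance τ ⟨$⟩ʳ (τ ⟨$⟩ʳ o) ≡ o
  advance-succ τ = trans (cong (λ j → PC.transpose b o (τ ⟨$⟩ʳ j)) (transpose-matchʳ o b))
                         (transpose-matchˡ b o)
    where
    b : Fin n
    b = τ ⟨$⟩ʳ o

  retreat-point : ∀ σ → retreat σ ⟨$⟩ʳ o ≡ σ ⟨$⟩ˡ o
  retreat-point σ = trans (cong (λ j → PC.transpose o a (σ ⟨$⟩ʳ j)) (transpose-matchʳ a o))
                          (trans (cong (PC.transpose o a) (inverseʳ σ)) (transpose-matchˡ o a))
    where
    a : Fin n
    a = σ ⟨$⟩ˡ o

  retreat-advance : ∀ τ → retreat (advance τ) ≋ τ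
  retreat-advance τ i =
    trans (cong (λ b → conjugate (flip (transpose o b)) (advance τ) ⟨$⟩ʳ i)
                (sym (⟨$⟩ʳ≡⇒≡⟨$⟩ˡ (advance τ) (advance-succ τ))))
          (conjugate-inverseˡ (transpose o (τ ⟨$⟩ʳ o)) τ i)

  advance-retreat : ∀ σ → advance (retreat σ) ≋ σ
  advance-retreat σ i =
    trans (cong (λ a → conjugate (transpose o a) (retreat σ) ⟨$⟩ʳ i) (retreat-point σ))
          (conjugate-inverseʳ (transpose o (σ ⟨$⟩ˡ o)) σ i)

  advance-injective : ∀ {σ τ} → advance σ ≋ advance τ → σ ≋ τ
  advance-injective {σ} {τ} eq i = trans (sym (retreat-advance σ i))
    (trans (retreat-cong {advance σ} {advance τ} eq i) (retreat-advance τ i))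

  -- τ with o cut out of its cycle; the value at o itself is junk.
  skip : Permutation′ n → Fin n → Fin n
  skip τ j with τ ⟨$⟩ʳ j ≟ o
  ... | yes _ = τ ⟨$⟩ʳ o
  ... | no  _ = τ ⟨$⟩ʳ j

  skip-pred : ∀ τ {j} → τ ⟨$⟩ʳ j ≡ o → skip τ j ≡ τ ⟨$⟩ʳ o
  skip-pred τ {j} τj≡o with τ ⟨$⟩ʳ j ≟ o
  ... | yes _    = refl
  ... | no τj≢o = contradiction τj≡o τj≢o

  skip-other : ∀ τ {j} → τ ⟨$⟩ʳ j ≢ o → skip τ j ≡ τ ⟨$⟩ʳ j
  skip-other τ {j} τj≢o with τ ⟨$⟩ʳ j ≟ o
  ... | yes τj≡o = contradiction τj≡o τj≢o
  ... | no _     = refl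

  skip-cong : ∀ {σ τ} → σ ≋ τ → ∀ j → skip σ j ≡ skip τ j
  skip-cong {σ} {τ} eq j with τ ⟨$⟩ʳ j ≟ o
  ... | yes τj≡o = trans (skip-pred σ (trans (eq j) τj≡o)) (eq o)
  ... | no τj≢o  = trans (skip-other σ (τj≢o ∘ trans (sym (eq j)))) (eq j)

  module OnLongCycle (τ : Permutation′ n)
                     (b≢o : τ ⟨$⟩ʳ o ≢ o) (c≢o : τ ⟨$⟩ʳ (τ ⟨$⟩ʳ o) ≢ o) where

    a b c : Fin n
    a = τ ⟨$⟩ˡ o
    b = τ ⟨$⟩ʳ o
    c = τ ⟨$⟩ʳ b

    τa≡o : τ ⟨$⟩ʳ a ≡ o
    τa≡o = inverseʳ τ

    a≢o : a ≢ o
    a≢o a≡o = b≢o (trans (cong (τ ⟨$⟩ʳ_) (sym a≡o)) τa≡o)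

    a≢b : a ≢ b
    a≢b a≡b = c≢o (trans (cong (τ ⟨$⟩ʳ_) (sym a≡b)) τa≡o)

    c≢b : c ≢ b
    c≢b c≡b = b≢o (⟨$⟩ʳ-injective τ c≡b)

    advance-pred : advance τ ⟨$⟩ʳ a ≡ b
    advance-pred = trans (cong (λ j → PC.transpose b o (τ ⟨$⟩ʳ j)) (transpose-other a≢o a≢b))
                         (trans (cong (PC.transpose b o) τa≡o) (transpose-matchʳ b o))

    advance-point : advance τ ⟨$⟩ʳ o ≡ c
    advance-point = trans (cong (λ j → PC.transpose b o (τ ⟨$⟩ʳ j)) (transpose-matchˡ o b))
                          (transpose-other c≢b c≢o)

    advance-other : ∀ {j} → j ≢ o → j ≢ a → j ≢ b → advance τ ⟨$⟩ʳ j ≡ τ ⟨$⟩ʳ j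
    advance-other j≢o j≢a j≢b =
      trans (cong (λ j → PC.transpose b o (τ ⟨$⟩ʳ j)) (transpose-other j≢o j≢b))
            (transpose-other (j≢o ∘ ⟨$⟩ʳ-injective τ) (j≢a ∘ ⟨$⟩ʳ≡⇒≡⟨$⟩ˡ τ))

    skip-advance : ∀ {j} → j ≢ o → skip (advance τ) j ≡ skip τ j
    skip-advance {j} j≢o with j ≟ a | j ≟ b
    ... | yes refl | _ = trans (skip-other (advance τ) (b≢o ∘ trans (sym advance-pred)))
                               (trans advance-pred (sym (skip-pred τ τa≡o)))
    ... | no _ | yes refl = trans (skip-pred (advance τ) (advance-succ τ))
                                  (trans advance-point (sym (skip-other τ c≢o)))
    ... | no j≢a | no j≢b =
      trans (skip-other (advance τ) (τj≢o ∘ trans (sym (advance-other j≢o j≢a j≢b))))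
            (trans (advance-other j≢o j≢a j≢b) (sym (skip-other τ τj≢o)))
      where
      τj≢o : τ ⟨$⟩ʳ j ≢ o
      τj≢o = j≢a ∘ ⟨$⟩ʳ≡⇒≡⟨$⟩ˡ τ

  advance-isNCycle : ∀ {τ} → IsNCycle τ → IsNCycle (advance τ)
  advance-isNCycle {τ} = conjugate-isNCycle (transpose o (τ ⟨$⟩ʳ o))

  retreat-isNCycle : ∀ {σ} → IsNCycle σ → IsNCycle (retreat σ)
  retreat-isNCycle {σ} = conjugate-isNCycle (flip (transpose o (σ ⟨$⟩ˡ o)))

  map-advance-enumerates : ∀ {L} → EnumeratesNCycles L → EnumeratesNCycles (map advance L)
  map-advance-enumerates {L} (cycles , complete , unique) =
    All.map⁺ (All.map advance-isNCycle cycles) ,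
    complete′ ,
    AllPairs.map⁺ (AllPairs.map (λ {σ} {τ} σ≉τ eq → σ≉τ (advance-injective {σ} {τ} eq)) unique)
    where
    complete′ : ∀ σ → IsNCycle σ → Any (σ ≋_) (map advance L)
    complete′ σ cycle = Any.map⁺ (Any.map
      (λ {τ} eq i → trans (sym (advance-retreat σ i)) (advance-cong {retreat σ} {τ} eq i))
      (complete (retreat σ) (retreat-isNCycle cycle)))

module _ {a p} {A : Set a} {P : A → Set p} where

  Any-─ : ∀ {q} {Q : A → Set q} {xs} (i : Any P xs) →
          Any Q xs → ¬ Q (Any.lookup i) → Any Q (xs ─ i)
  Any-─ (here _)  (here qx)  ¬qx = contradiction qx ¬qx
  Any-─ (here _)  (there qs) _   = qs
  Any-─ (there _) (here qx)  _   = here qx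
  Any-─ (there i) (there qs) ¬qx = there (Any-─ i qs ¬qx)

  AllPairs-─ : ∀ {r} {R : A → A → Set r} {xs} (i : Any P xs) →
               AllPairs R xs → AllPairs R (xs ─ i)
  AllPairs-─ (here _)  (_ ∷ rs)  = rs
  AllPairs-─ (there i) (rx ∷ rs) = ─⁺ i rx ∷ AllPairs-─ i rs

module _ {s ℓ p} (S : Setoid s ℓ) {P : Setoid.Carrier S → Set p} where
  open Setoid S using (_≉_) renaming (sym to ≈-sym)
  open Unique S using (Unique)

  Unique⇒─≉lookup : ∀ {xs} → Unique xs → (i : Any P xs) → All (_≉ Any.lookup i) (xs ─ i)
  Unique⇒─≉lookup (x≉xs ∷ _)   (here _)  = All.map (_∘ ≈-sym) x≉xs
  Unique⇒─≉lookup (x≉xs ∷ xs!) (there i) =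
    proj₁ (All.lookupAny x≉xs i) ∷ Unique⇒─≉lookup xs! i

module FieldProperties {c ℓ} (F : Field c ℓ) where
  open Field F hiding (zero)
    renaming (refl to ≈-refl; sym to ≈-sym; trans to ≈-trans; reflexive to ≈-reflexive)
  open FieldOps F
  open import Relation.Binary.Reasoning.Setoid setoid
  open import Tactic.RingSolver.NonReflective (fromCommutativeRing commutativeRing (λ _ → nothing))
  open import Algebra.Properties.CommutativeSemigroup *-commutativeSemigroup
    using (x∙yz≈y∙xz)
  open import Algebra.Properties.CommutativeSemigroup +-commutativeSemigroup
    using () renaming (x∙yz≈y∙xz to x+[y+z]≈y+[x+z])
  open import Algebra.Properties.Group +-group
    using (x∙y⁻¹≈ε⇒x≈y) renaming (⁻¹-involutive to -‿involutive)
  open import Algebra.Properties.AbelianGroup +-abelianGroup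
    using () renaming (⁻¹-anti-homo‿- to -‿anti-homo‿-)
  open import Algebra.Properties.Ring ring using (-‿distribˡ-*; -‿distribʳ-*)

  x≉y⇒x-y≉0 : ∀ {x y} → x ≉ y → x - y ≉ 0#
  x≉y⇒x-y≉0 {x} {y} x≉y = x≉y ∘ x∙y⁻¹≈ε⇒x≈y x y

  *≈1⇒≉0 : ∀ {u v} → u * v ≈ 1# → u ≉ 0#
  *≈1⇒≉0 {u} {v} uv≈1 u≈0 = 0≉1 (begin
    0#      ≈⟨ ≈-sym (zeroˡ v) ⟩
    0# * v  ≈⟨ *-congʳ (≈-sym u≈0) ⟩
    u * v   ≈⟨ uv≈1 ⟩
    1#      ∎)

  ⁻¹-cancelˡ : ∀ {u} → u ≉ 0# → ∀ v → u ⁻¹ * (u * v) ≈ v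
  ⁻¹-cancelˡ {u} u≉0 v = begin
    u ⁻¹ * (u * v)  ≈⟨ *-assoc (u ⁻¹) u v ⟨
    (u ⁻¹ * u) * v  ≈⟨ *-congʳ (*-comm (u ⁻¹) u) ⟩
    (u * u ⁻¹) * v  ≈⟨ *-congʳ (inverse u u≉0) ⟩
    1# * v          ≈⟨ *-identityˡ v ⟩
    v               ∎

  ⁻¹-unique : ∀ {u v} → u * v ≈ 1# → v ≈ u ⁻¹
  ⁻¹-unique {u} {v} uv≈1 = begin
    v               ≈⟨ ≈-sym (⁻¹-cancelˡ (*≈1⇒≉0 uv≈1) v) ⟩
    u ⁻¹ * (u * v)  ≈⟨ *-congˡ uv≈1 ⟩
    u ⁻¹ * 1#       ≈⟨ *-identityʳ (u ⁻¹) ⟩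
    u ⁻¹            ∎

  -‿⁻¹ : ∀ {u} → u ≉ 0# → (- u) ⁻¹ ≈ - (u ⁻¹)
  -‿⁻¹ {u} u≉0 = ≈-sym (⁻¹-unique (begin
    (- u) * (- (u ⁻¹))  ≈⟨ -‿distribˡ-* u (- (u ⁻¹)) ⟨
    - (u * - (u ⁻¹))    ≈⟨ -‿cong (-‿distribʳ-* u (u ⁻¹)) ⟨
    - (- (u * u ⁻¹))    ≈⟨ -‿involutive (u * u ⁻¹) ⟩
    u * u ⁻¹            ≈⟨ inverse u u≉0 ⟩
    1#                  ∎))

  sum-of-inverses : ∀ {u v} → u ≉ 0# → v ≉ 0# → u ⁻¹ + v ⁻¹ ≈ (u + v) * (u ⁻¹ * v ⁻¹)
  sum-of-inverses {u} {v} u≉0 v≉0 = ≈-sym (begin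
    (u + v) * (u ⁻¹ * v ⁻¹)                    ≈⟨ distribʳ _ u v ⟩
    u * (u ⁻¹ * v ⁻¹) + v * (u ⁻¹ * v ⁻¹)      ≈⟨ +-cong (*-assoc u _ _) (x∙yz≈y∙xz (u ⁻¹) v _) ⟨
    (u * u ⁻¹) * v ⁻¹ + u ⁻¹ * (v * v ⁻¹)      ≈⟨ +-cong (*-congʳ (inverse u u≉0))
                                                          (*-congˡ (inverse v v≉0)) ⟩
    1# * v ⁻¹ + u ⁻¹ * 1#                      ≈⟨ +-cong (*-identityˡ _) (*-identityʳ _) ⟩
    v ⁻¹ + u ⁻¹                                ≈⟨ +-comm _ _ ⟩
    u ⁻¹ + v ⁻¹                                ∎)

  partial-fractions : ∀ {p q r} → q ≉ p → r ≉ q → r ≉ p →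
                      (r - q) ⁻¹ * (q - p) ⁻¹ ≈ (r - p) ⁻¹ * ((q - p) ⁻¹ - (q - r) ⁻¹)
  partial-fractions {p} {q} {r} q≉p r≉q r≉p = begin
    (r - q) ⁻¹ * (q - p) ⁻¹                              ≈⟨ *-comm _ _ ⟩
    (q - p) ⁻¹ * (r - q) ⁻¹                              ≈⟨ ⁻¹-cancelˡ (x≉y⇒x-y≉0 r≉p) _ ⟨
    (r - p) ⁻¹ * ((r - p) * ((q - p) ⁻¹ * (r - q) ⁻¹))   ≈⟨ *-congˡ (*-congʳ r-p≈[q-p]+[r-q]) ⟩
    (r - p) ⁻¹ * (((q - p) + (r - q)) * ((q - p) ⁻¹ * (r - q) ⁻¹))
                                                         ≈⟨ *-congˡ (sum-of-inverses
                                                              (x≉y⇒x-y≉0 q≉p) (x≉y⇒x-y≉0 r≉q)) ⟨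
    (r - p) ⁻¹ * ((q - p) ⁻¹ + (r - q) ⁻¹)               ≈⟨ *-congˡ (+-congˡ [r-q]⁻¹≈-[q-r]⁻¹) ⟩
    (r - p) ⁻¹ * ((q - p) ⁻¹ - (q - r) ⁻¹)               ∎
    where
    [r-q]⁻¹≈-[q-r]⁻¹ : (r - q) ⁻¹ ≈ - (q - r) ⁻¹
    [r-q]⁻¹≈-[q-r]⁻¹ = ≈-trans (⁻¹-cong (≈-sym (-‿anti-homo‿- q r)))
                               (-‿⁻¹ (x≉y⇒x-y≉0 (r≉q ∘ ≈-sym)))
    r-p≈[q-p]+[r-q] : r - p ≈ (q - p) + (r - q)
    r-p≈[q-p]+[r-q] = ≈-sym (begin
      (q - p) + (r - q)  ≈⟨ solve 3 (λ p q r → ((q ⊕ (⊝ p)) ⊕ (r ⊕ (⊝ q)))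
                                              ⊜ ((r ⊕ (⊝ p)) ⊕ (q ⊕ (⊝ q)))) ≈-refl p q r ⟩
      (r - p) + (q - q)  ≈⟨ +-congˡ (-‿inverseʳ q) ⟩
      (r - p) + 0#       ≈⟨ +-identityʳ (r - p) ⟩
      r - p              ∎)

  ∏-cong : ∀ n {g g′ : Vector Carrier n} → (∀ j → g j ≈ g′ j) → ∏ n g ≈ ∏ n g′
  ∏-cong 0       _    = ≈-refl
  ∏-cong (suc n) g≈g′ = *-cong (g≈g′ zero) (∏-cong n (g≈g′ ∘ suc))

  ∏-extract : ∀ n (g : Vector Carrier n) i → ∏ n g ≈ g i * ∏ n (g [ i ]≔ 1#)
  ∏-extract (suc n) g zero    = *-congˡ (≈-sym (*-identityˡ _))
  ∏-extract (suc n) g (suc i) = ≈-trans (*-congˡ (∏-extract n (g ∘ suc) i)) (x∙yz≈y∙xz _ _ _)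

  []≔-cong-at : ∀ {n} {g g′ : Vector Carrier n} {i} v j →
                (j ≢ i → g j ≈ g′ j) → (g [ i ]≔ v) j ≈ (g′ [ i ]≔ v) j
  []≔-cong-at {g = g} {g′} {i} v j g≈g′ with j ≟ i
  ... | yes refl = ≈-reflexive (trans (updateAt-updates i g) (sym (updateAt-updates i g′)))
  ... | no j≢i   = ≈-trans (≈-reflexive (updateAt-minimal j i g j≢i))
                           (≈-trans (g≈g′ j≢i) (≈-reflexive (sym (updateAt-minimal j i g′ j≢i))))

  module _ {a} {A : Set a} where

    Σlist-cong : ∀ {p} {P : A → Set p} {f g : A → Carrier} xs → All P xs →
                 (∀ {t} → P t → f t ≈ g t) → Σlist xs f ≈ Σlist xs g
    Σlist-cong []       []         f≈g = ≈-refl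
    Σlist-cong (t ∷ xs) (pt ∷ pxs) f≈g = +-cong (f≈g pt) (Σlist-cong xs pxs f≈g)

    Σlist-distrib-- : ∀ (f g : A → Carrier) xs →
                      Σlist xs (λ t → f t - g t) ≈ Σlist xs f - Σlist xs g
    Σlist-distrib-- f g []       = ≈-sym (-‿inverseʳ 0#)
    Σlist-distrib-- f g (t ∷ xs) = ≈-trans (+-congˡ (Σlist-distrib-- f g xs))
      (solve 4 (λ a b c d → ((a ⊕ (⊝ b)) ⊕ (c ⊕ (⊝ d))) ⊜ ((a ⊕ c) ⊕ (⊝ (b ⊕ d)))) ≈-refl _ _ _ _)

    Σlist-map : ∀ (φ : A → A) (h : A → Carrier) xs → Σlist (map φ xs) h ≡ Σlist xs (h ∘ φ)
    Σlist-map φ h []       = refl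
    Σlist-map φ h (t ∷ xs) = cong (h (φ t) +_) (Σlist-map φ h xs)

    Σlist-─ : ∀ {p} {P : A → Set p} (h : A → Carrier) {xs} (q : Any P xs) →
              Σlist xs h ≈ h (Any.lookup q) + Σlist (xs ─ q) h
    Σlist-─ h (here _)  = ≈-refl
    Σlist-─ h (there q) = ≈-trans (+-congˡ (Σlist-─ h q)) (x+[y+z]≈y+[x+z] _ _ _)

  module _ {s ℓ′} (S : Setoid s ℓ′) {h : Setoid.Carrier S → Carrier}
           (h-cong : ∀ {u v} → Setoid._≈_ S u v → h u ≈ h v) where
    open Setoid S using ()
      renaming (Carrier to Element; _≈_ to _∼_; _≉_ to _≁_; sym to ∼-sym; trans to ∼-trans)
    open Membership S using (_∈_)
    open Unique S using (Unique)

    Σlist-unique-cong : ∀ {xs ys} → Unique xs → Unique ys →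
                        All (_∈ ys) xs → All (_∈ xs) ys → Σlist xs h ≈ Σlist ys h
    Σlist-unique-cong {[]}     {[]}    _ _ _ _        = ≈-refl
    Σlist-unique-cong {[]}     {_ ∷ _} _ _ _ (() ∷ _)
    Σlist-unique-cong {x ∷ xs} {ys} (x≁xs ∷ xs!) ys! (x∈ys ∷ xs⊆ys) ys⊆x∷xs = begin
      h x + Σlist xs h                 ≈⟨ +-cong (h-cong x∼y) (Σlist-unique-cong xs! ys─! xs⊆ys─ ys─⊆xs) ⟩
      h y + Σlist (ys ─ x∈ys) h        ≈⟨ Σlist-─ h x∈ys ⟨
      Σlist ys h                       ∎
      where
      y : Element
      y = Any.lookup x∈ys
      x∼y : x ∼ y
      x∼y = lookup-result x∈ys
      ys─! : Unique (ys ─ x∈ys)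
      ys─! = AllPairs-─ x∈ys ys!
      xs⊆ys─ : All (_∈ (ys ─ x∈ys)) xs
      xs⊆ys─ = All.zipWith (λ (v∈ys , x≁v) → Any-─ x∈ys v∈ys (x≁v ∘ ∼-trans x∼y ∘ ∼-sym))
                           (xs⊆ys , x≁xs)
      drop-x : ∀ {v} → v ∈ x ∷ xs × v ≁ y → v ∈ xs
      drop-x (here v∼x  , v≁y) = contradiction (∼-trans v∼x x∼y) v≁y
      drop-x (there v∈xs , _)  = v∈xs
      ys─⊆xs : All (_∈ xs) (ys ─ x∈ys)
      ys─⊆xs = All.zipWith drop-x (─⁺ x∈ys ys⊆x∷xs , Unique⇒─≉lookup S ys! x∈ys)

-- Telescoping

module CycleSum {c ℓ} (F : Field c ℓ) {n : ℕ} (x : Fin n → Field.Carrier F)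
                (x-injective : ∀ i j → i ≢ j → ¬ Field._≈_ F (x i) (x j)) (o : Fin n) where
  open Field F hiding (zero)
    renaming (refl to ≈-refl; sym to ≈-sym; trans to ≈-trans; reflexive to ≈-reflexive)
  open FieldOps F
  open FieldProperties F
  open Advance o
  open import Relation.Binary.Reasoning.Setoid setoid
  open import Algebra.Properties.Ring ring using ([y-z]x≈yx-zx)

  weight : (Fin n → Fin n) → Fin n → Carrier
  weight s j = (x (s j) - x j) ⁻¹

  -- Setting the factor at o to 1 leaves the product for the (n−1)-cycle skip τ.
  cutProduct : Permutation′ n → Carrier
  cutProduct τ = (x o - x (τ ⟨$⟩ˡ o)) ⁻¹ * ∏ n (weight (skip τ) [ o ]≔ 1#)

  weight-cong : ∀ {k k′ j} → k ≡ k′ → (x k - x j) ⁻¹ ≈ (x k′ - x j) ⁻¹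
  weight-cong {j = j} eq = ≈-reflexive (cong (λ k → (x k - x j) ⁻¹) eq)

  cutProduct-cong : ∀ {σ τ} → σ ≋ τ → cutProduct σ ≈ cutProduct τ
  cutProduct-cong {σ} {τ} eq =
    *-cong (≈-reflexive (cong (λ k → (x o - x k) ⁻¹) (⟨$⟩ˡ-cong {σ = σ} {τ = τ} eq o)))
           (∏-cong n (λ j → []≔-cong-at 1# j (λ _ → weight-cong (skip-cong {σ} {τ} eq j))))

  module _ (τ : Permutation′ n)
           (b≢o : τ ⟨$⟩ʳ o ≢ o) (c≢o : τ ⟨$⟩ʳ (τ ⟨$⟩ʳ o) ≢ o) where
    open OnLongCycle τ b≢o c≢o

    rest : Carrier
    rest = ∏ n ((weight (τ ⟨$⟩ʳ_) [ o ]≔ 1#) [ a ]≔ 1#)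

    ∏weight-split : ∏ n (weight (τ ⟨$⟩ʳ_)) ≈ (x b - x o) ⁻¹ * ((x o - x a) ⁻¹ * rest)
    ∏weight-split = ≈-trans (∏-extract n w o) (*-congˡ (≈-trans (∏-extract n (w [ o ]≔ 1#) a)
      (*-congʳ (≈-trans (≈-reflexive (updateAt-minimal a o w a≢o)) (weight-cong τa≡o)))))
      where
      w : Vector Carrier n
      w = weight (τ ⟨$⟩ʳ_)

    ∏cut-split : ∏ n (weight (skip τ) [ o ]≔ 1#) ≈ (x b - x a) ⁻¹ * rest
    ∏cut-split = ≈-trans (∏-extract n (w [ o ]≔ 1#) a) (*-cong
      (≈-trans (≈-reflexive (updateAt-minimal a o w a≢o)) (weight-cong (skip-pred τ τa≡o)))
      (∏-cong n (λ j → []≔-cong-at 1# j (λ j≢a → []≔-cong-at 1# j (λ _ →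
        weight-cong (skip-other τ (j≢a ∘ ⟨$⟩ʳ≡⇒≡⟨$⟩ˡ τ)))))))
      where
      w : Vector Carrier n
      w = weight (skip τ)

    cutProduct-advance : cutProduct (advance τ) ≈ (x o - x b) ⁻¹ * ∏ n (weight (skip τ) [ o ]≔ 1#)
    cutProduct-advance = *-cong
      (≈-reflexive (cong (λ k → (x o - x k) ⁻¹) (sym (⟨$⟩ʳ≡⇒≡⟨$⟩ˡ (advance τ) (advance-succ τ)))))
      (∏-cong n (λ j → []≔-cong-at 1# j
        (weight-cong ∘ skip-advance)))

    ∏weight≈cutProduct-difference :
      ∏ n (weight (τ ⟨$⟩ʳ_)) ≈ cutProduct τ - cutProduct (advance τ)
    ∏weight≈cutProduct-difference = begin
      ∏ n (weight (τ ⟨$⟩ʳ_))                     ≈⟨ ∏weight-split ⟩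
      B * (A * rest)                             ≈⟨ *-assoc B A rest ⟨
      (B * A) * rest                             ≈⟨ *-congʳ (partial-fractions xo≉xa xb≉xo xb≉xa) ⟩
      (D * (A - E)) * rest                       ≈⟨ *-congʳ (*-comm D (A - E)) ⟩
      ((A - E) * D) * rest                       ≈⟨ *-assoc (A - E) D rest ⟩
      (A - E) * (D * rest)                       ≈⟨ [y-z]x≈yx-zx (D * rest) A E ⟩
      A * (D * rest) - E * (D * rest)            ≈⟨ +-cong (*-congˡ ∏cut-split)
                                                           (-‿cong (*-congˡ ∏cut-split)) ⟨
      cutProduct τ - E * ∏ n (weight (skip τ) [ o ]≔ 1#)
                                                 ≈⟨ +-congˡ (-‿cong cutProduct-advance) ⟨
      cutProduct τ - cutProduct (advance τ)      ∎
      where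
      A B D E : Carrier
      A = (x o - x a) ⁻¹
      B = (x b - x o) ⁻¹
      D = (x b - x a) ⁻¹
      E = (x o - x b) ⁻¹
      xo≉xa : x o ≉ x a
      xo≉xa = x-injective o a (a≢o ∘ sym)
      xb≉xo : x b ≉ x o
      xb≉xo = x-injective b o b≢o
      xb≉xa : x b ≉ x a
      xb≉xa = x-injective b a (a≢b ∘ sym)

  Σlist-cutProduct∘advance : ∀ {L} → EnumeratesNCycles L →
                             Σlist L (cutProduct ∘ advance) ≈ Σlist L cutProduct
  Σlist-cutProduct∘advance {L} enumerates@(cycles , complete , unique) =
    let cycles′ , complete′ , unique′ = map-advance-enumerates enumerates in
    begin
      Σlist L (cutProduct ∘ advance)    ≡⟨ Σlist-map advance cutProduct L ⟨
      Σlist (map advance L) cutProduct  ≈⟨ Σlist-unique-cong ≋-setoid cutProduct-cong unique′ unique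
                                             (All.map (complete _) cycles′)
                                             (All.map (complete′ _) cycles) ⟩
      Σlist L cutProduct                ∎

third-point : ∀ {k} (b : Fin (suc (suc (suc k)))) → ∃ λ j → j ≢ zero × j ≢ b
third-point zero          = suc zero , (λ ()) , (λ ())
third-point (suc zero)    = suc (suc zero) , (λ ()) , (λ ())
third-point (suc (suc _)) = suc zero , (λ ()) , (λ ())

lemma3p2 : ∀ {c ℓ} (F : Field c ℓ) → IsCharZeroAlgClosed F →
           (n : ℕ) → n > 2 →
           (x : Fin n → Field.Carrier F) →
           (∀ i j → ¬ (i ≡ j) → ¬ (Field._≈_ F (x i) (x j))) →
           (L : List (Permutation′ n)) → EnumeratesNCycles L →
           Field._≈_ F (cycleSum F x L) (Field.0# F)
lemma3p2 F _ (suc (suc (suc k))) (s≤s (s≤s (s≤s _))) x x-injective L enumerates@(cycles , _) =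
  begin
    cycleSum F x L                                         ≈⟨ Σlist-cong L cycles telescopes ⟩
    Σlist L (λ τ → cutProduct τ - cutProduct (advance τ))  ≈⟨ Σlist-distrib-- _ _ L ⟩
    Σlist L cutProduct - Σlist L (cutProduct ∘ advance)    ≈⟨ +-congˡ (-‿cong
                                                                (Σlist-cutProduct∘advance enumerates)) ⟩
    Σlist L cutProduct - Σlist L cutProduct                ≈⟨ -‿inverseʳ _ ⟩
    0#                                                     ∎
  where
  open Field F hiding (zero)
  open FieldOps F using (∏; Σlist)
  open FieldProperties F using (Σlist-cong; Σlist-distrib--)
  open CycleSum F x x-injective zero
  open Advance zero using (advance)
  open import Relation.Binary.Reasoning.Setoid setoid

  telescopes : ∀ {τ} → IsNCycle τ →
               ∏ _ (weight (τ ⟨$⟩ʳ_)) ≈ cutProduct τ - cutProduct (advance τ)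
  telescopes {τ} cycle =
    let j , j≢0 , j≢b = third-point (τ ⟨$⟩ʳ zero)
    in ∏weight≈cutProduct-difference τ (IsNCycle⇒¬fixed cycle {suc zero} (λ ()))
                                       (IsNCycle⇒¬2-periodic cycle j≢0 j≢b)
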